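{- Let $m>n$, $w_0=(n,n-1,\dots,2,1)\in\mathfrak{S}_n$, and $\pi'=(n,n-1,\dots,2,1,n+1,n+2,\dots,m)\in\mathfrak{S}_m$. Then $|\mathcal{O}_{\mathrm{MVP}_m}^{ -1}(\pi')| = |\mathcal{M}_n|$, the number of Motzkin paths of length $n$.
   Context: A Motzkin path of length $n$ is a lattice path from $(0,0)$ to $(n,0)$ with steps $(1,0)$, $(1,1)$, $(1,-1)$ that never goes below the $x$-axis; $\mathcal{M}_n$ is the set of them. For any $N$: spots $1,\dots,N$ on a one-way street; cars $1,\dots,N$ arrive in order with preferences $\alpha=(a_1,\dots,a_N)\in[N]^N$. MVP parking rule: when car $i$ arrives, if spot $a_i$ is unoccupied, car $i$ parks there; if spot $a_i$ is occupied by an earlier car $j$, then car $i$ parks in spot $a_i$ and car $j$ is bumped and parks in the first unoccupied spot among $a_i+1,\dots,N$, if any (otherwise car $j$ fails to park); a bumped car never bumps another car. $\alpha$ is an MVP parking function of length $N$ if all cars park; its outcome $\mathcal{O}_{\mathrm{MVP}_N}(\alpha)$ is the permutation (in one-line notation) whose $j$th entry is the car parked in spot $j$; $\mathcal{O}_{\mathrm{MVP}_N}^{ -1}(\pi)$ is the set of MVP parking functions of length $N$ with outcome $\pi$. -}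

module Defs where

open import Data.Nat using (ℕ; zero; suc; _<ᵇ_; _∸_)
open import Data.Fin using (Fin; toℕ)
open import Data.Vec using (Vec; []; _∷_; lookup; _[_]≔_; replicate; tabulate; toList)
open import Data.List using (List; []; _∷_)
open import Data.List as L using ()
open import Data.Maybe using (Maybe; just; nothing)
open import Data.Bool using (Bool; true; false; if_then_else_)
open import Data.Unit using (⊤)
open import Data.Empty using (⊥)
open import Data.Product using (Σ)
open import Relation.Binary.PropositionalEquality using (_≡_)

-- Spots 1..N are represented by Fin N (spot k+1 ↔ index k).
-- Cars are labelled by natural numbers 1..N (car i is the i-th to arrive).

Config : ℕ → Set
Config N = Vec (Maybe ℕ) N

isEmpty : Maybe ℕ → Bool
isEmpty nothing  = true
isEmpty (just _) = false

firstFreeIn : ∀ {N} → Config N → List (Fin N) → Maybe (Fin N)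
firstFreeIn occ []       = nothing
firstFreeIn occ (k ∷ ks) = if isEmpty (lookup occ k) then just k else firstFreeIn occ ks

firstFreeAfter : ∀ {N} → Config N → Fin N → Maybe (Fin N)
firstFreeAfter {N} occ a =
  firstFreeIn occ (L.filterᵇ (λ k → toℕ a <ᵇ toℕ k) (L.allFin N))

mvpStep : ∀ {N} → Config N → ℕ → Fin N → Maybe (Config N)
mvpStep occ c a with lookup occ a
... | nothing = just (occ [ a ]≔ just c)
... | just j with firstFreeAfter occ a
...   | nothing = nothing
...   | just k  = just ((occ [ a ]≔ just c) [ k ]≔ just j)

mvpRun : ∀ {N} → Config N → ℕ → List (Fin N) → Maybe (Config N)
mvpRun occ c []       = just occ
mvpRun occ c (a ∷ as) with mvpStep occ c a
... | nothing   = nothing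
... | just occ′ = mvpRun occ′ (suc c) as

allParked : ∀ {N} → Vec (Maybe ℕ) N → Maybe (Vec ℕ N)
allParked []             = just []
allParked (nothing ∷ xs) = nothing
allParked (just c ∷ xs) with allParked xs
... | nothing = nothing
... | just ys = just (c ∷ ys)

-- MVP outcome of a preference list α ∈ [N]^N: just π (π in one-line
-- notation, entry j = car parked in spot j) if all cars park, nothing otherwise.
mvpOutcome : ∀ {N} → Vec (Fin N) N → Maybe (Vec ℕ N)
mvpOutcome {N} α with mvpRun (replicate N nothing) 1 (toList α)
... | nothing  = nothing
... | just occ = allParked occ

MVPFiber : (N : ℕ) → Vec ℕ N → Set
MVPFiber N π = Σ (Vec (Fin N) N) (λ α → mvpOutcome α ≡ just π)

piPrime : (m n : ℕ) → Vec ℕ m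
piPrime m n = tabulate (λ j → if toℕ j <ᵇ n then n ∸ toℕ j else suc (toℕ j))

-- Motzkin paths, as sequences of steps U=(1,1), D=(1,-1), F=(1,0)

data Step : Set where
  U D F : Step

IsMotzkinFrom : ℕ → List Step → Set
IsMotzkinFrom zero    []      = ⊤
IsMotzkinFrom (suc h) []      = ⊥
IsMotzkinFrom h       (U ∷ s) = IsMotzkinFrom (suc h) s
IsMotzkinFrom zero    (D ∷ s) = ⊥
IsMotzkinFrom (suc h) (D ∷ s) = IsMotzkinFrom h s
IsMotzkinFrom h       (F ∷ s) = IsMotzkinFrom h s

MotzkinPath : ℕ → Set
MotzkinPath n = Σ (Vec Step n) (λ s → IsMotzkinFrom zero (toList s))

-- A preference list in the fibre of π′ is read off as a Motzkin path on its first n cars.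
-- Car k + 1 takes a level step F if it parks at once in its final spot, an up step U if it
-- parks in the final spot of a later car that will bump it home, and a down step D if it
-- prefers its own final spot and bumps the car waiting there.  A bumped car moves to the first
-- free spot on its right, which has to be its own final spot, so all spots in between are
-- filled and the bumps nest like matched parentheses; cars n + 1, …, m must prefer their own
-- spots.  Conversely a Motzkin path prescribes every preference: the car of a U step prefers
-- the final spot of the car of the matching D step.  The configuration after k cars is given
-- explicitly by `occupant`; each MVP step of an encoded path preserves this description, and
-- any step ending in such a configuration starts from one, which gives both directions.

module Submission where

open import Defs
open import Axiom.UniquenessOfIdentityProofs using (module Decidable⇒UIP)
open import Data.Bool using (T; true; false; if_then_else_)
open import Data.Fin as F using (Fin; toℕ)
import Data.Fin.Properties as F
open import Data.List as L using (List; []; _∷_; length; _++_)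
import Data.List.Properties as L
open import Data.List.Membership.Propositional using (_∈_; _∉_)
open import Data.List.Membership.Propositional.Properties
  using (∈-filter⁺; ∈-filter⁻; ∈-allFin; ∈-map⁻)
open import Data.List.Relation.Unary.All as All using (All; []; _∷_)
open import Data.List.Relation.Unary.Any using (here; there)
open import Data.List.Relation.Unary.AllPairs as AllPairs using (AllPairs; []; _∷_)
import Data.List.Relation.Unary.AllPairs.Properties as AllPairsₚ
open import Data.Maybe using (Maybe; just; nothing)
open import Data.Maybe.Properties using (just-injective)
import Data.Maybe.Properties as Maybe
open import Data.Nat
  using (ℕ; zero; suc; _+_; _∸_; _≤_; _<_; _>_; z≤n; s≤s; _≤?_; _<?_; _≟_; _<ᵇ_)
open import Data.Nat.Properties
open import Data.List.Membership.DecPropositional _≟_ using (_∈?_)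
open import Data.Product using (∃; _×_; _,_; proj₁; proj₂)
open import Data.Sum using (_⊎_; inj₁; inj₂)
open import Data.Unit using (tt)
open import Data.Vec as V using (Vec; []; _∷_; lookup; _[_]≔_; replicate; tabulate; toList)
open import Data.Vec.Properties
  using ( tabulate∘lookup; tabulate-cong; []≔-idempotent; []≔-lookup
        ; lookup∘update; lookup∘update′
        ; toList-cast; toList∘fromList; toList-injective; lookup∘tabulate; lookup-map; lookup-replicate
        ; length-toList )
import Data.Vec.Properties as Vec
open import Data.Vec.Relation.Binary.Equality.Cast using (cast-is-id)
open import Function.Base using (_∘_)
open import Function.Bundles using (_↔_; mk↔ₛ′)
open import Relation.Binary.Definitions using (tri<; tri≈; tri>)
open import Relation.Binary.PropositionalEquality
open import Relation.Nullary using (Dec; yes; no; contradiction)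
open import Relation.Nullary.Decidable.Core using (T?)

private
  variable
    A : Set
    N : ℕ
    C C′ : Config N
    c j k x y : ℕ
    O : List ℕ
    s : List Step

lookup-ext : {u v : Vec A N} → (∀ i → lookup u i ≡ lookup v i) → u ≡ v
lookup-ext {u = u} {v} u≗v = begin
  u                   ≡⟨ tabulate∘lookup u ⟨
  tabulate (lookup u) ≡⟨ tabulate-cong u≗v ⟩
  tabulate (lookup v) ≡⟨ tabulate∘lookup v ⟩
  v                   ∎
  where open ≡-Reasoning

vecOf : (xs : List A) → length xs ≡ N → Vec A N
vecOf xs e = V.cast e (V.fromList xs)

toList-vecOf : (xs : List A) (e : length xs ≡ N) → toList (vecOf xs e) ≡ xs
toList-vecOf xs e = trans (toList-cast e (V.fromList xs)) (toList∘fromList xs)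

toList-injective′ : {u v : Vec A N} → toList u ≡ toList v → u ≡ v
toList-injective′ {u = u} {v} e = trans (sym (cast-is-id refl u)) (toList-injective refl u v e)

[]≔-undo : {u v : Vec A N} {i : Fin N} {x y : A} →
                 lookup u i ≡ x → u [ i ]≔ y ≡ v → u ≡ v [ i ]≔ x
[]≔-undo {u = u} {i = i} refl refl = sym (trans ([]≔-idempotent u i) ([]≔-lookup u i))

private
  if-<ᵇ-true : ∀ {a b : A} {p q} → p < q → (if p <ᵇ q then a else b) ≡ a
  if-<ᵇ-true {p = p} {q} p<q with p <ᵇ q | <⇒<ᵇ p<q
  ... | true | _ = refl

  if-<ᵇ-false : ∀ {a b : A} {p q} → q ≤ p → (if p <ᵇ q then a else b) ≡ b
  if-<ᵇ-false {p = p} {q} q≤p with p <ᵇ q | <ᵇ⇒< p q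
  ... | false | _   = refl
  ... | true  | p<q = contradiction (p<q _) (≤⇒≯ q≤p)

-- The MVP rule

data StepView (C : Config N) (c : ℕ) (a : Fin N) : Config N → Set where
  park : lookup C a ≡ nothing → StepView C c a (C [ a ]≔ just c)
  bump : ∀ j q → lookup C a ≡ just j → firstFreeAfter C a ≡ just q →
         StepView C c a ((C [ a ]≔ just c) [ q ]≔ just j)

mvpStep-view : ∀ c a → mvpStep C c a ≡ just C′ → StepView C c a C′
mvpStep-view {C = C} c a eq with lookup C a in e
mvpStep-view c a refl | nothing = park e
mvpStep-view {C = C} c a eq | just j with firstFreeAfter C a in e′
mvpStep-view c a refl | just j | just q = bump j q e e′

mvpStep-park : ∀ c a → lookup C a ≡ nothing → mvpStep C c a ≡ just (C [ a ]≔ just c)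
mvpStep-park c a e rewrite e = refl

mvpStep-bump : ∀ c a {j q} → lookup C a ≡ just j → firstFreeAfter C a ≡ just q →
               mvpStep C c a ≡ just ((C [ a ]≔ just c) [ q ]≔ just j)
mvpStep-bump c a e e′ rewrite e | e′ = refl

mvpRun-∷ : ∀ c a as → mvpStep C c a ≡ just C′ → mvpRun C c (a ∷ as) ≡ mvpRun C′ (suc c) as
mvpRun-∷ c a as e rewrite e = refl

mvpRun-∷⁻ : ∀ c a as {T : Config N} → mvpRun C c (a ∷ as) ≡ just T →
            ∃ λ C′ → mvpStep C c a ≡ just C′ × mvpRun C′ (suc c) as ≡ just T
mvpRun-∷⁻ {C = C} c a as run with mvpStep C c a
mvpRun-∷⁻ c a as ()  | nothing
mvpRun-∷⁻ c a as run | just C′ = C′ , refl , run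

record FirstFreeAfter (C : Config N) (a q : Fin N) : Set where
  field
    after    : a F.< q
    free     : lookup C q ≡ nothing
    occupied : ∀ p → a F.< p → p F.< q → lookup C p ≢ nothing

private
  FirstFreeIn : Config N → List (Fin N) → Fin N → Set
  FirstFreeIn C ks q =
    q ∈ ks × lookup C q ≡ nothing × (∀ p → p ∈ ks → p F.< q → lookup C p ≢ nothing)

  firstFreeIn-sound : ∀ ks {q} → AllPairs F._<_ ks → firstFreeIn C ks ≡ just q → FirstFreeIn C ks q
  firstFreeIn-sound {C = C} (k ∷ ks) (k<ks ∷ sorted) eq with lookup C k in e
  ... | nothing rewrite just-injective (sym eq) =
    here refl , e , λ { p (here refl) p<k _ → <-irrefl refl p<k
                      ; p (there p∈ks) p<k _ → <-asym p<k (All.lookup k<ks p∈ks) }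
  ... | just j with firstFreeIn-sound ks sorted eq
  ...   | q∈ks , free , occupied =
    there q∈ks , free , λ { p (here refl) _ p-free → contradiction (trans (sym e) p-free) λ ()
                          ; p (there p∈ks) p<q → occupied p p∈ks p<q }

  firstFreeIn-complete : ∀ ks {q} → AllPairs F._<_ ks → FirstFreeIn C ks q →
                         firstFreeIn C ks ≡ just q
  firstFreeIn-complete (k ∷ ks) sorted (here refl , free , _) rewrite free = refl
  firstFreeIn-complete {C = C} (k ∷ ks) (k<ks ∷ sorted) (there q∈ks , free , occupied)
    with lookup C k in e
  ... | nothing = contradiction e (occupied k (here refl) (All.lookup k<ks q∈ks))
  ... | just _  = firstFreeIn-complete ks sorted
                    (q∈ks , free , λ p p∈ks → occupied p (there p∈ks))

  module SpotsAfter (a : Fin N) where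
    After : Fin N → Set
    After k = T (toℕ a <ᵇ toℕ k)

    after? : ∀ k → Dec (After k)
    after? k = T? (toℕ a <ᵇ toℕ k)

    spots : List (Fin N)
    spots = L.filter after? (L.allFin N)

    sorted : AllPairs F._<_ spots
    sorted = AllPairsₚ.filter⁺ after? (AllPairsₚ.tabulate⁺-< (λ i<j → i<j))

    ∈⁺ : ∀ p → a F.< p → p ∈ spots
    ∈⁺ p a<p = ∈-filter⁺ after? (∈-allFin p) (<⇒<ᵇ a<p)

    ∈⁻ : ∀ p → p ∈ spots → a F.< p
    ∈⁻ p p∈ = <ᵇ⇒< _ _ (proj₂ (∈-filter⁻ after? {xs = L.allFin N} p∈))

firstFreeAfter-sound : ∀ {a q} → firstFreeAfter C a ≡ just q → FirstFreeAfter C a q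
firstFreeAfter-sound {C = C} {a} {q} eq = sound (firstFreeIn-sound spots sorted eq)
  where
    open SpotsAfter a
    sound : FirstFreeIn C spots q → FirstFreeAfter C a q
    sound (q∈ , free , occupied) = record
      { after    = ∈⁻ q q∈
      ; free     = free
      ; occupied = λ p a<p → occupied p (∈⁺ p a<p)
      }

firstFreeAfter-complete : ∀ {a q} → FirstFreeAfter C a q → firstFreeAfter C a ≡ just q
firstFreeAfter-complete {a = a} {q} ff =
  firstFreeIn-complete spots sorted (∈⁺ q after , free , λ p p∈ → occupied p (∈⁻ p p∈))
  where open SpotsAfter a
        open FirstFreeAfter ff

StepView-arrival : ∀ {c a} → StepView C c a C′ → lookup C′ a ≡ just c
StepView-arrival {C = C} {c = c} {a} (park _) = lookup∘update a C (just c)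
StepView-arrival {C = C} {c = c} {a} (bump j q _ e) =
  trans (lookup∘update′ a≢q (C [ a ]≔ just c) (just j)) (lookup∘update a C (just c))
  where
    a≢q : a ≢ q
    a≢q = F.<⇒≢ (FirstFreeAfter.after (firstFreeAfter-sound e))

allParked-map-just : (π : Vec ℕ N) → allParked (V.map just π) ≡ just π
allParked-map-just []      = refl
allParked-map-just (c ∷ π) rewrite allParked-map-just π = refl

allParked≡just⇒ : ∀ (C : Config N) {π} → allParked C ≡ just π → C ≡ V.map just π
allParked≡just⇒ []           refl = refl
allParked≡just⇒ (nothing ∷ C) ()
allParked≡just⇒ (just c ∷ C)  e with allParked C in e′
allParked≡just⇒ (just c ∷ C) () | nothing
allParked≡just⇒ (just c ∷ C) refl | just π = cong (just c ∷_) (allParked≡just⇒ C e′)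

mvpOutcome-run : ∀ (α : Vec (Fin N) N) {π} → mvpOutcome α ≡ just π →
                 mvpRun (replicate N nothing) 1 (toList α) ≡ just (V.map just π)
mvpOutcome-run {N} α e with mvpRun (replicate N nothing) 1 (toList α)
mvpOutcome-run α () | nothing
mvpOutcome-run α e  | just C = cong just (allParked≡just⇒ C e)

mvpOutcome-run⁻ : ∀ (α : Vec (Fin N) N) {π} →
                  mvpRun (replicate N nothing) 1 (toList α) ≡ just (V.map just π) →
                  mvpOutcome α ≡ just π
mvpOutcome-run⁻ α {π} e rewrite e = allParked-map-just π

MVPFiber-≡ : ∀ {π : Vec ℕ N} {f g : MVPFiber N π} → proj₁ f ≡ proj₁ g → f ≡ g
MVPFiber-≡ {f = α , p} {.α , q} refl =
  cong (α ,_) (Decidable⇒UIP.≡-irrelevant (Maybe.≡-dec (Vec.≡-dec _≟_)) p q)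

-- Motzkin paths as stack programs

-- closingIndex t s is the position of the step at which s first descends below height −t.
closingIndex : ℕ → List Step → ℕ
closingIndex t       []      = 0
closingIndex t       (U ∷ s) = suc (closingIndex (suc t) s)
closingIndex t       (F ∷ s) = suc (closingIndex t s)
closingIndex zero    (D ∷ s) = 0
closingIndex (suc t) (D ∷ s) = suc (closingIndex t s)

closingIndex<length : ∀ h s {i} → IsMotzkinFrom h s → i < h → closingIndex i s < length s
closingIndex<length zero    (U ∷ s)         p i<h = s≤s (closingIndex<length 1 s p (s≤s i<h))
closingIndex<length (suc h) (U ∷ s)         p i<h =
  s≤s (closingIndex<length (suc (suc h)) s p (s≤s i<h))
closingIndex<length zero    (F ∷ s)         p i<h = s≤s (closingIndex<length zero s p i<h)
closingIndex<length (suc h) (F ∷ s)         p i<h = s≤s (closingIndex<length (suc h) s p i<h)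
closingIndex<length (suc h) (D ∷ s) {zero}  p i<h = s≤s z≤n
closingIndex<length (suc h) (D ∷ s) {suc i} p i<h = s≤s (closingIndex<length h s p (≤-pred i<h))

IsMotzkinFrom-irrelevant : ∀ h s (p q : IsMotzkinFrom h s) → p ≡ q
IsMotzkinFrom-irrelevant zero    []      tt tt = refl
IsMotzkinFrom-irrelevant zero    (U ∷ s) p  q  = IsMotzkinFrom-irrelevant 1 s p q
IsMotzkinFrom-irrelevant (suc h) (U ∷ s) p  q  = IsMotzkinFrom-irrelevant (suc (suc h)) s p q
IsMotzkinFrom-irrelevant zero    (F ∷ s) p  q  = IsMotzkinFrom-irrelevant zero s p q
IsMotzkinFrom-irrelevant (suc h) (F ∷ s) p  q  = IsMotzkinFrom-irrelevant (suc h) s p q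
IsMotzkinFrom-irrelevant (suc h) (D ∷ s) p  q  = IsMotzkinFrom-irrelevant h s p q

IsMotzkinFrom-U⁻ : ∀ h {s} → IsMotzkinFrom h (U ∷ s) → IsMotzkinFrom (suc h) s
IsMotzkinFrom-U⁻ zero    p = p
IsMotzkinFrom-U⁻ (suc h) p = p

IsMotzkinFrom-U⁺ : ∀ h {s} → IsMotzkinFrom (suc h) s → IsMotzkinFrom h (U ∷ s)
IsMotzkinFrom-U⁺ zero    p = p
IsMotzkinFrom-U⁺ (suc h) p = p

IsMotzkinFrom-F⁻ : ∀ h {s} → IsMotzkinFrom h (F ∷ s) → IsMotzkinFrom h s
IsMotzkinFrom-F⁻ zero    p = p
IsMotzkinFrom-F⁻ (suc h) p = p

IsMotzkinFrom-F⁺ : ∀ h {s} → IsMotzkinFrom h s → IsMotzkinFrom h (F ∷ s)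
IsMotzkinFrom-F⁺ zero    p = p
IsMotzkinFrom-F⁺ (suc h) p = p

-- Reading a path as stack operations (U pushes an unknown entry, D pops),
-- poppedAt stack s d is the entry popped by the step of s at position d.
poppedAt : List (Maybe ℕ) → List Step → ℕ → Maybe ℕ
poppedAt stack       []      d       = nothing
poppedAt stack       (U ∷ s) zero    = nothing
poppedAt stack       (U ∷ s) (suc d) = poppedAt (nothing ∷ stack) s d
poppedAt stack       (F ∷ s) zero    = nothing
poppedAt stack       (F ∷ s) (suc d) = poppedAt stack s d
poppedAt []          (D ∷ s) d       = nothing
poppedAt (o ∷ stack) (D ∷ s) zero    = o
poppedAt (o ∷ stack) (D ∷ s) (suc d) = poppedAt stack s d

poppedAt-closingIndex : ∀ pre {o st} s → IsMotzkinFrom (length (pre ++ o ∷ st)) s →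
                        poppedAt (pre ++ o ∷ st) s (closingIndex (length pre) s) ≡ o
poppedAt-closingIndex []        []      ()
poppedAt-closingIndex (_ ∷ pre) []      ()
poppedAt-closingIndex pre {o} {st} (U ∷ s) p =
  poppedAt-closingIndex (nothing ∷ pre) s (IsMotzkinFrom-U⁻ (length (pre ++ o ∷ st)) p)
poppedAt-closingIndex pre {o} {st} (F ∷ s) p =
  poppedAt-closingIndex pre s (IsMotzkinFrom-F⁻ (length (pre ++ o ∷ st)) p)
poppedAt-closingIndex []        (D ∷ s) p = refl
poppedAt-closingIndex (_ ∷ pre) (D ∷ s) p = poppedAt-closingIndex pre s p

poppedAt-otherTop : ∀ pre {o o′ st} s d → d ≢ closingIndex (length pre) s →
                    poppedAt (pre ++ o ∷ st) s d ≡ poppedAt (pre ++ o′ ∷ st) s d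
poppedAt-otherTop pre       []      d       _ = refl
poppedAt-otherTop pre       (U ∷ s) zero    _ = refl
poppedAt-otherTop pre       (U ∷ s) (suc d) d≢ =
  poppedAt-otherTop (nothing ∷ pre) s d (λ e → d≢ (cong suc e))
poppedAt-otherTop pre       (F ∷ s) zero    _ = refl
poppedAt-otherTop pre       (F ∷ s) (suc d) d≢ = poppedAt-otherTop pre s d (λ e → d≢ (cong suc e))
poppedAt-otherTop []        (D ∷ s) zero    d≢ = contradiction refl d≢
poppedAt-otherTop []        (D ∷ s) (suc d) _ = refl
poppedAt-otherTop (_ ∷ pre) (D ∷ s) zero    _ = refl
poppedAt-otherTop (_ ∷ pre) (D ∷ s) (suc d) d≢ = poppedAt-otherTop pre s d (λ e → d≢ (cong suc e))

poppedAt-beforeClosing : ∀ pre {st} s d → All (_≡ nothing) pre → d < closingIndex (length pre) s →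
                         poppedAt (pre ++ st) s d ≡ nothing
poppedAt-beforeClosing pre       (U ∷ s) zero    _ _ = refl
poppedAt-beforeClosing pre       (U ∷ s) (suc d) ps d< =
  poppedAt-beforeClosing (nothing ∷ pre) s d (refl ∷ ps) (≤-pred d<)
poppedAt-beforeClosing pre       (F ∷ s) zero    _ _ = refl
poppedAt-beforeClosing pre       (F ∷ s) (suc d) ps d< = poppedAt-beforeClosing pre s d ps (≤-pred d<)
poppedAt-beforeClosing (_ ∷ pre) (D ∷ s) zero    (p ∷ _) _ = p
poppedAt-beforeClosing (_ ∷ pre) (D ∷ s) (suc d) (_ ∷ ps) d< =
  poppedAt-beforeClosing pre s d ps (≤-pred d<)

poppedAt-∈ : ∀ stack s d {c} → poppedAt stack s d ≡ just c → just c ∈ stack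
poppedAt-∈ stack       (U ∷ s) (suc d) e with poppedAt-∈ (nothing ∷ stack) s d e
... | there c∈ = c∈
poppedAt-∈ stack       (F ∷ s) (suc d) e = poppedAt-∈ stack s d e
poppedAt-∈ (o ∷ stack) (D ∷ s) zero    e = here (sym e)
poppedAt-∈ (o ∷ stack) (D ∷ s) (suc d) e = there (poppedAt-∈ stack s d e)

poppedAt-[] : ∀ s d → poppedAt [] s d ≡ nothing
poppedAt-[] s d with poppedAt [] s d in e
... | nothing = refl
... | just c with () ← poppedAt-∈ [] s d e

MotzkinPath-≡ : ∀ {n} {p q : MotzkinPath n} → proj₁ p ≡ proj₁ q → p ≡ q
MotzkinPath-≡ {p = v , p} {.v , q} refl = cong (v ,_) (IsMotzkinFrom-irrelevant 0 (toList v) p q)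

-- Occupancies

-- An occupancy records, for (the label of) each car, which car sits in its final spot.
Occupancy : Set
Occupancy = ℕ → Maybe ℕ

private
  variable
    f g : Occupancy
    v : Maybe ℕ

opaque
  _[_↦_] : Occupancy → ℕ → Maybe ℕ → Occupancy
  (f [ x ↦ v ]) y with y ≟ x
  ... | yes _ = v
  ... | no  _ = f y

  ↦-same : (f [ x ↦ v ]) x ≡ v
  ↦-same {x = x} with x ≟ x
  ... | yes _   = refl
  ... | no  x≢x = contradiction refl x≢x

  ↦-other : y ≢ x → (f [ x ↦ v ]) y ≡ f y
  ↦-other {y} {x} y≢x with y ≟ x
  ... | yes y≡x = contradiction y≡x y≢x
  ... | no  _   = refl

∉-above : All (_< x) O → x ∉ O
∉-above O<x x∈O = <-irrefl refl (All.lookup O<x x∈O)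

parkedUnlessOpen : List ℕ → ℕ → Maybe ℕ
parkedUnlessOpen O x with x ∈? O
... | yes _ = nothing
... | no  _ = just x

parkedUnlessOpen-∈ : x ∈ O → parkedUnlessOpen O x ≡ nothing
parkedUnlessOpen-∈ {x} {O} x∈O with x ∈? O
... | yes _  = refl
... | no x∉O = contradiction x∈O x∉O

parkedUnlessOpen-∉ : x ∉ O → parkedUnlessOpen O x ≡ just x
parkedUnlessOpen-∉ {x} {O} x∉O with x ∈? O
... | yes x∈O = contradiction x∈O x∉O
... | no _    = refl

parkedUnlessOpen-∷ : ∀ {y} → x ≢ y → parkedUnlessOpen (y ∷ O) x ≡ parkedUnlessOpen O x
parkedUnlessOpen-∷ {x} {O} {y} x≢y = by-membership (x ∈? O)
  where
    by-membership : Dec (x ∈ O) → parkedUnlessOpen (y ∷ O) x ≡ parkedUnlessOpen O x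
    by-membership (yes x∈O) = trans (parkedUnlessOpen-∈ (there x∈O)) (sym (parkedUnlessOpen-∈ x∈O))
    by-membership (no x∉O)  =
      trans (parkedUnlessOpen-∉ λ { (here x≡y) → x≢y x≡y ; (there x∈O) → x∉O x∈O })
            (sym (parkedUnlessOpen-∉ x∉O))

parkedUnlessOpen⁻ : parkedUnlessOpen O x ≡ just j → x ∉ O × j ≡ x
parkedUnlessOpen⁻ {O} {x} e with x ∈? O
parkedUnlessOpen⁻ () | yes _
parkedUnlessOpen⁻ refl | no x∉O = x∉O , refl

-- the car whose D step matches the U step of car k + 1 when s follows that U step
matchingCar : ℕ → List Step → ℕ
matchingCar k s = suc (suc k) + closingIndex 0 s

data Relative (k : ℕ) : ℕ → Set where
  past  : x ≤ k → Relative k x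
  ahead : ∀ d → Relative k (suc k + d)

relative : ∀ k x → Relative k x
relative k x with x ≤? k
... | yes x≤k = past x≤k
... | no  x≰k = subst (Relative k) (m+[n∸m]≡n (≰⇒> x≰k)) (ahead (x ∸ suc k))

-- occupant k O s describes the configuration after cars 1, …, k have parked following
-- the encoding of a Motzkin path whose unread suffix is s; O lists the cars of the still
-- unmatched U steps, innermost first.  An open car waits in the final spot of the car
-- whose D step matches its U step, i.e. of the car that will bump it home.
opaque
  occupant : ℕ → List ℕ → List Step → Occupancy
  occupant k O s x with x ≤? k
  ... | yes _ = parkedUnlessOpen O x
  ... | no  _ = poppedAt (L.map just O) s (x ∸ suc k)

  occupant-past : x ≤ k → occupant k O s x ≡ parkedUnlessOpen O x
  occupant-past {x} {k} x≤k with x ≤? k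
  ... | yes _   = refl
  ... | no  x≰k = contradiction x≤k x≰k

  occupant-ahead : ∀ d → x ≡ suc k + d → occupant k O s x ≡ poppedAt (L.map just O) s d
  occupant-ahead {k = k} {O = O} {s = s} d refl with suc k + d ≤? k
  ... | yes k+d<k = contradiction k+d<k (<⇒≱ (s≤s (m≤m+n k d)))
  ... | no  _     = cong (poppedAt (L.map just O) s) (m+n∸m≡n (suc k) d)

occupant-parked : x ≤ k → x ∉ O → occupant k O s x ≡ just x
occupant-parked x≤k x∉O = trans (occupant-past x≤k) (parkedUnlessOpen-∉ x∉O)

occupant-open : x ≤ k → x ∈ O → occupant k O s x ≡ nothing
occupant-open x≤k x∈O = trans (occupant-past x≤k) (parkedUnlessOpen-∈ x∈O)

occupant-past⁻ : x ≤ k → occupant k O s x ≡ just j → x ∉ O × j ≡ x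
occupant-past⁻ x≤k e = parkedUnlessOpen⁻ (trans (sym (occupant-past x≤k)) e)

occupant≢nothing⇒∉ : x ≤ k → occupant k O s x ≢ nothing → x ∉ O
occupant≢nothing⇒∉ x≤k occupied x∈O = occupied (occupant-open x≤k x∈O)

occupant-F-arrival : occupant k O (F ∷ s) (suc k) ≡ nothing
occupant-F-arrival {k} = occupant-ahead 0 (sym (+-identityʳ (suc k)))

occupant-F-other : x ≢ suc k → occupant k O (F ∷ s) x ≡ occupant (suc k) O s x
occupant-F-other {x} {k} x≢ with relative k x
... | past x≤k     = trans (occupant-past x≤k) (sym (occupant-past (m≤n⇒m≤1+n x≤k)))
... | ahead zero    = contradiction (+-identityʳ (suc k)) x≢
... | ahead (suc d) = trans (occupant-ahead (suc d) refl) (sym (occupant-ahead d (+-suc (suc k) d)))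

private
  motzkin-mapJust : IsMotzkinFrom (suc (length O)) s → IsMotzkinFrom (suc (length (L.map just O))) s
  motzkin-mapJust {O} {s} = subst (λ h → IsMotzkinFrom (suc h) s) (sym (L.length-map just O))

occupant-U-match : IsMotzkinFrom (suc (length O)) s → occupant k O (U ∷ s) (matchingCar k s) ≡ nothing
occupant-U-match {O = O} {s = s} {k = k} p =
  trans (occupant-ahead (suc (closingIndex 0 s)) (sym (+-suc (suc k) (closingIndex 0 s))))
        (poppedAt-closingIndex [] s (motzkin-mapJust {O = O} {s = s} p))

occupant-U-arrival : IsMotzkinFrom (suc (length O)) s →
                     occupant (suc k) (suc k ∷ O) s (matchingCar k s) ≡ just (suc k)
occupant-U-arrival {O = O} {s = s} {k = k} p =
  trans (occupant-ahead (closingIndex 0 s) refl)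
        (poppedAt-closingIndex [] s (motzkin-mapJust {O = O} {s = s} p))

occupant-U-beforeMatch : occupant (suc k) (suc k ∷ O) s (suc k + closingIndex 0 s) ≡ nothing
occupant-U-beforeMatch {k} {O} {s} with closingIndex 0 s in eq
... | zero  = occupant-open (≤-reflexive (+-identityʳ (suc k))) (here (+-identityʳ (suc k)))
... | suc c = trans (occupant-ahead c (+-suc (suc k) c))
                    (poppedAt-beforeClosing [] s c [] (subst (c <_) (sym eq) (n<1+n c)))

occupant-U-other : x ≢ matchingCar k s → occupant k O (U ∷ s) x ≡ occupant (suc k) (suc k ∷ O) s x
occupant-U-other {x} {k} {s} {O} x≢ with relative k x
... | past x≤k =
  trans (occupant-past x≤k)
        (trans (sym (parkedUnlessOpen-∷ (<⇒≢ (s≤s x≤k))))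
               (sym (occupant-past (m≤n⇒m≤1+n x≤k))))
... | ahead zero =
  trans (occupant-ahead 0 refl)
        (sym (occupant-open (≤-reflexive (+-identityʳ (suc k))) (here (+-identityʳ (suc k)))))
... | ahead (suc d) =
  trans (occupant-ahead (suc d) refl)
        (trans (poppedAt-otherTop [] s d d≢)
               (sym (occupant-ahead d (+-suc (suc k) d))))
  where
    d≢ : d ≢ closingIndex 0 s
    d≢ d≡ = x≢ (trans (+-suc (suc k) d) (cong (suc (suc k) +_) d≡))

occupant-D-arrival : occupant k (j ∷ O) (D ∷ s) (suc k) ≡ just j
occupant-D-arrival {k} = occupant-ahead 0 (sym (+-identityʳ (suc k)))

occupant-D-bumped : j ≤ k → occupant k (j ∷ O) (D ∷ s) j ≡ nothing
occupant-D-bumped j≤k = occupant-open j≤k (here refl)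

occupant-D-other : x ≢ suc k → x ≢ j → occupant k (j ∷ O) (D ∷ s) x ≡ occupant (suc k) O s x
occupant-D-other {x = x} {k = k} {j = j} {O = O} x≢k+1 x≢j with relative k x
... | past x≤k =
  trans (occupant-past x≤k)
        (trans (parkedUnlessOpen-∷ x≢j) (sym (occupant-past (m≤n⇒m≤1+n x≤k))))
... | ahead zero    = contradiction (+-identityʳ (suc k)) x≢k+1
... | ahead (suc d) =
  trans (occupant-ahead {O = j ∷ O} (suc d) refl) (sym (occupant-ahead {O = O} d (+-suc (suc k) d)))

private
  ∈-mapJust⁻ : just c ∈ L.map just O → c ∈ O
  ∈-mapJust⁻ c∈ with ∈-map⁻ just c∈
  ... | _ , c∈O , refl = c∈O

  largest-is-head : ∀ {o} → AllPairs _>_ (o ∷ O) → o ≤ c → c ∈ o ∷ O → o ≡ c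
  largest-is-head _             _   (here c≡o)  = sym c≡o
  largest-is-head (o>O ∷ _) o≤c (there c∈O) = contradiction o≤c (<⇒≱ (All.lookup o>O c∈O))

occupant-arrival⁻ : AllPairs _>_ O → All (_≤ suc k) O → occupant (suc k) O s x ≡ just (suc k) →
                    (∃ λ O₀ → O ≡ suc k ∷ O₀ × x ≡ matchingCar k s) ⊎
                    (suc k ∉ O × x ≡ suc k)
occupant-arrival⁻ {O} {k} {s} {x} dec bnd e with relative (suc k) x
... | past x≤ with occupant-past⁻ x≤ e
...   | x∉O , refl = inj₂ (x∉O , refl)
occupant-arrival⁻ {O} {k} {s} dec bnd e | ahead d =
  ahead-case O dec bnd (∈-mapJust⁻ (poppedAt-∈ _ s d popped)) popped
  where
    popped : poppedAt (L.map just O) s d ≡ just (suc k)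
    popped = trans (sym (occupant-ahead {k = suc k} {O = O} {s = s} d refl)) e

    ahead-case : ∀ O → AllPairs _>_ O → All (_≤ suc k) O → suc k ∈ O →
                 poppedAt (L.map just O) s d ≡ just (suc k) →
                 (∃ λ O₀ → O ≡ suc k ∷ O₀ × suc (suc k) + d ≡ matchingCar k s) ⊎
                 (suc k ∉ O × suc (suc k) + d ≡ suc k)
    ahead-case (o ∷ O₀) dec@(o>O₀ ∷ _) (o≤ ∷ _) k+1∈ popped with largest-is-head dec o≤ k+1∈
    ... | refl with d ≟ closingIndex 0 s
    ...   | yes refl = inj₁ (O₀ , refl , refl)
    ...   | no d≢
      with poppedAt-∈ _ s d (trans (sym (poppedAt-otherTop [] {o′ = nothing} s d d≢)) popped)
    ...     | here ()
    ...     | there k+1∈ = contradiction (All.lookup o>O₀ (∈-mapJust⁻ k+1∈)) (<-irrefl refl)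

occupant-initial : 0 < x → occupant 0 [] s x ≡ nothing
occupant-initial {x} {s} 0<x with relative 0 x
... | past x≤0 = contradiction 0<x (≤⇒≯ x≤0)
... | ahead d  = trans (occupant-ahead d refl) (poppedAt-[] s d)

bump-neighbour-occupied : ∀ {X} → y < suc X → g y ≡ just j →
                          (∀ z → y < z → z < suc X → g z ≢ nothing) → g X ≢ nothing
bump-neighbour-occupied {X = X} y<X+1 gy≡ between gX≡ with m≤n⇒m<n∨m≡n (≤-pred y<X+1)
... | inj₁ y<X    = between X y<X (n<1+n X) gX≡
... | inj₂ refl   = contradiction (trans (sym gy≡) gX≡) λ ()

-- Encoding Motzkin paths as preference lists

module Correspondence {M n : ℕ} (n≤M : n ≤ M) where

  private
    variable
      O′ : List ℕ
      s′ : List Step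
      σ σ′ : Step

  m : ℕ
  m = suc M

  opaque
    -- truncates at M; only ever applied to numbers ≤ M
    toFin : ℕ → Fin m
    toFin x = F.fromℕ< (s≤s (m⊓n≤n x M))

    toℕ-toFin : x ≤ M → toℕ (toFin x) ≡ x
    toℕ-toFin {x} x≤M = trans (F.toℕ-fromℕ< _) (m≤n⇒m⊓n≡m x≤M)

    -- spot x is the final spot of car x ≤ n, namely n + 1 − x (counting from 1)
    spot : ℕ → Fin m
    spot x = toFin (n ∸ x)

    toℕ-spot : ∀ x → toℕ (spot x) ≡ n ∸ x
    toℕ-spot x = toℕ-toFin (≤-trans (m∸n≤m n x) n≤M)

  spot<n : 0 < x → x ≤ n → toℕ (spot x) < n
  spot<n {x} 0<x x≤n = subst (_< n) (sym (toℕ-spot x)) (∸-monoʳ-< 0<x x≤n)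

  ∸-spot : x ≤ n → n ∸ toℕ (spot x) ≡ x
  ∸-spot {x} x≤n = trans (cong (n ∸_) (toℕ-spot x)) (m∸[m∸n]≡n x≤n)

  spot-injective : x ≤ n → y ≤ n → spot x ≡ spot y → x ≡ y
  spot-injective {x} {y} x≤n y≤n e =
    ∸-cancelˡ-≡ x≤n y≤n (trans (sym (toℕ-spot x)) (trans (cong toℕ e) (toℕ-spot y)))

  spot-< : y < x → x ≤ n → spot x F.< spot y
  spot-< {y} {x} y<x x≤n = subst₂ _<_ (sym (toℕ-spot x)) (sym (toℕ-spot y)) (∸-monoʳ-< y<x x≤n)

  spot-<⁻ : spot x F.< spot y → y < x
  spot-<⁻ {x} {y} sx<sy = ≰⇒> λ x≤y →
    <⇒≱ (subst₂ _<_ (toℕ-spot x) (toℕ-spot y) sx<sy) (∸-monoʳ-≤ n x≤y)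

  data SpotView : Fin m → Set where
    carSpot : ∀ x → 0 < x → x ≤ n → SpotView (spot x)
    beyond  : ∀ {i} → n ≤ toℕ i → SpotView i

  spotView : ∀ i → SpotView i
  spotView i with toℕ i <? n
  ... | no  i≮n = beyond (≮⇒≥ i≮n)
  ... | yes i<n = subst SpotView spot≡i (carSpot (n ∸ toℕ i) (m<n⇒0<n∸m i<n) (m∸n≤m n (toℕ i)))
    where
      spot≡i : spot (n ∸ toℕ i) ≡ i
      spot≡i = F.toℕ-injective (trans (toℕ-spot (n ∸ toℕ i)) (m∸[m∸n]≡n (<⇒≤ i<n)))

  opaque
    layoutCell : Occupancy → Fin m → Maybe ℕ
    layoutCell f i with toℕ i <? n
    ... | yes _ = f (n ∸ toℕ i)
    ... | no  _ = nothing

    layout : Occupancy → Config m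
    layout f = tabulate (layoutCell f)

    lookup-layout-spot : 0 < x → x ≤ n → lookup (layout f) (spot x) ≡ f x
    lookup-layout-spot {x} {f} 0<x x≤n
      rewrite lookup∘tabulate (layoutCell f) (spot x) with toℕ (spot x) <? n
    ... | yes _      = cong f (∸-spot x≤n)
    ... | no  sx≮n   = contradiction (spot<n 0<x x≤n) sx≮n

    lookup-layout-beyond : ∀ {i} → n ≤ toℕ i → lookup (layout f) i ≡ nothing
    lookup-layout-beyond {f} {i} n≤i rewrite lookup∘tabulate (layoutCell f) i with toℕ i <? n
    ... | yes i<n = contradiction i<n (≤⇒≯ n≤i)
    ... | no  _   = refl

  infix 4 _≈_
  _≈_ : Occupancy → Occupancy → Set
  f ≈ g = ∀ x → 0 < x → x ≤ n → f x ≡ g x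

  layout-cong : f ≈ g → layout f ≡ layout g
  layout-cong {f} {g} f≈g = lookup-ext λ i → pointwise i (spotView i)
    where
      pointwise : ∀ i → SpotView i → lookup (layout f) i ≡ lookup (layout g) i
      pointwise _ (carSpot x 0<x x≤n) =
        trans (lookup-layout-spot 0<x x≤n) (trans (f≈g x 0<x x≤n) (sym (lookup-layout-spot 0<x x≤n)))
      pointwise _ (beyond n≤i) = trans (lookup-layout-beyond n≤i) (sym (lookup-layout-beyond n≤i))

  layout-update : 0 < x → x ≤ n → layout f [ spot x ]≔ v ≡ layout (f [ x ↦ v ])
  layout-update {x} {f} {v} 0<x x≤n = lookup-ext pointwise
    where
      pointwise : ∀ i → lookup (layout f [ spot x ]≔ v) i ≡ lookup (layout (f [ x ↦ v ])) i
      pointwise i with i F.≟ spot x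
      ... | yes refl = trans (lookup∘update (spot x) (layout f) v)
                             (sym (trans (lookup-layout-spot 0<x x≤n) ↦-same))
      ... | no  i≢x  = trans (lookup∘update′ i≢x (layout f) v) (unchanged i i≢x (spotView i))
        where
          unchanged : ∀ i → i ≢ spot x → SpotView i →
                      lookup (layout f) i ≡ lookup (layout (f [ x ↦ v ])) i
          unchanged _ sy≢sx (carSpot y 0<y y≤n) =
            trans (lookup-layout-spot 0<y y≤n)
                  (sym (trans (lookup-layout-spot 0<y y≤n)
                              (↦-other (λ y≡x → sy≢sx (cong spot y≡x)))))
          unchanged _ _ (beyond n≤i) = trans (lookup-layout-beyond n≤i) (sym (lookup-layout-beyond n≤i))

  data Occupied (f : Occupancy) (c : ℕ) : Fin m → Set where
    carAt : ∀ x → 0 < x → x ≤ n → f x ≡ just c → Occupied f c (spot x)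

  layout-occupied⁻ : ∀ i → lookup (layout f) i ≡ just c → Occupied f c i
  layout-occupied⁻ i e with spotView i
  ... | carSpot x 0<x x≤n = carAt x 0<x x≤n (trans (sym (lookup-layout-spot 0<x x≤n)) e)
  ... | beyond n≤i with () ← trans (sym (lookup-layout-beyond n≤i)) e

  layout-park : 0 < x → x ≤ n → f x ≡ nothing →
                mvpStep (layout f) c (spot x) ≡ just (layout (f [ x ↦ just c ]))
  layout-park 0<x x≤n fx≡ =
    trans (mvpStep-park _ (spot _) (trans (lookup-layout-spot 0<x x≤n) fx≡))
          (cong just (layout-update 0<x x≤n))

  layout-bump : ∀ {j} → 0 < y → y < x → x ≤ n → f x ≡ just j → f y ≡ nothing →
                (∀ z → y < z → z < x → f z ≢ nothing) →
                mvpStep (layout f) c (spot x) ≡ just (layout ((f [ x ↦ just c ]) [ y ↦ just j ]))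
  layout-bump {y} {x} {f} {c} 0<y y<x x≤n fx≡ fy≡ between =
    trans (mvpStep-bump c (spot x) (trans (lookup-layout-spot 0<x x≤n) fx≡) (firstFreeAfter-complete ff))
          (cong just (trans (cong (_[ spot y ]≔ _) (layout-update 0<x x≤n)) (layout-update 0<y y≤n)))
    where
      0<x : 0 < x
      0<x = <-trans 0<y y<x

      y≤n : y ≤ n
      y≤n = <⇒≤ (<-≤-trans y<x x≤n)

      ff : FirstFreeAfter (layout f) (spot x) (spot y)
      ff = record
        { after    = spot-< y<x x≤n
        ; free     = trans (lookup-layout-spot 0<y y≤n) fy≡
        ; occupied = λ p x<p p<y → occupiedBetween p x<p p<y (spotView p)
        }
        where
          occupiedBetween : ∀ p → spot x F.< p → p F.< spot y → SpotView p →
                            lookup (layout f) p ≢ nothing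
          occupiedBetween _ x<p p<y (carSpot z 0<z z≤) fz≡ =
            between z (spot-<⁻ p<y) (spot-<⁻ x<p) (trans (sym (lookup-layout-spot 0<z z≤)) fz≡)
          occupiedBetween _ _ p<y (beyond n≤p) =
            contradiction (<-trans p<y (spot<n 0<y y≤n)) (≤⇒≯ n≤p)

  data LayoutStep (g : Occupancy) (c : ℕ) : Fin m → Config m → Set where
    parked : ∀ x → 0 < x → x ≤ n → g x ≡ just c →
             LayoutStep g c (spot x) (layout (g [ x ↦ nothing ]))
    bumped : ∀ x y {j} → 0 < y → y < x → x ≤ n → g x ≡ just c → g y ≡ just j →
             (∀ z → y < z → z < x → g z ≢ nothing) →
             LayoutStep g c (spot x) (layout ((g [ y ↦ nothing ]) [ x ↦ just j ]))

  layoutStep⁻ : ∀ {C C′ a} → StepView C c a C′ → C′ ≡ layout g → LayoutStep g c a C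
  layoutStep⁻ {c} {g} {C} {a = a} v@(park free) C′≡
    with layout-occupied⁻ a (trans (cong (λ D → lookup D a) (sym C′≡)) (StepView-arrival v))
  ... | carAt x 0<x x≤n gx≡ =
    subst (LayoutStep g c (spot x)) (sym (trans ([]≔-undo free C′≡) (layout-update 0<x x≤n)))
          (parked x 0<x x≤n gx≡)
  layoutStep⁻ {c} {g} {C} {a = a} v@(bump j q e ff) C′≡
    with layout-occupied⁻ q (trans (cong (λ D → lookup D q) (sym C′≡))
                                   (lookup∘update q (C [ a ]≔ just c) (just j)))
       | layout-occupied⁻ a (trans (cong (λ D → lookup D a) (sym C′≡)) (StepView-arrival v))
  ... | carAt y 0<y y≤n gy≡ | carAt x 0<x x≤n gx≡ =
    subst (LayoutStep g c (spot x)) (sym C≡) (bumped x y 0<y y<x x≤n gx≡ gy≡ between)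
    where
      open FirstFreeAfter (firstFreeAfter-sound ff)
      y<x : y < x
      y<x = spot-<⁻ after

      h : Occupancy
      h = (g [ y ↦ nothing ]) [ x ↦ just j ]

      C≡ : C ≡ layout h
      C≡ = begin
        C                                                 ≡⟨ []≔-undo e C[x]≡ ⟩
        (layout g [ spot y ]≔ nothing) [ spot x ]≔ just j
          ≡⟨ cong (_[ spot x ]≔ just j) (layout-update 0<y y≤n) ⟩
        layout (g [ y ↦ nothing ]) [ spot x ]≔ just j     ≡⟨ layout-update 0<x x≤n ⟩
        layout h                                         ∎
        where
          open ≡-Reasoning
          C[x]≡ : C [ spot x ]≔ just c ≡ layout g [ spot y ]≔ nothing
          C[x]≡ = []≔-undo (trans (lookup∘update′ (F.<⇒≢ after ∘ sym) C (just c)) free)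
                                 C′≡

      between : ∀ z → y < z → z < x → g z ≢ nothing
      between z y<z z<x gz≡ = occupied (spot z) (spot-< z<x x≤n) (spot-< y<z z≤) (begin
        lookup C (spot z)          ≡⟨ cong (λ D → lookup D (spot z)) C≡ ⟩
        lookup (layout h) (spot z) ≡⟨ lookup-layout-spot 0<z z≤ ⟩
        h z                        ≡⟨ ↦-other (<⇒≢ z<x) ⟩
        (g [ y ↦ nothing ]) z      ≡⟨ ↦-other (>⇒≢ y<z) ⟩
        g z                        ≡⟨ gz≡ ⟩
        nothing                    ∎)
        where
          open ≡-Reasoning
          0<z : 0 < z
          0<z = <-trans 0<y y<z

          z≤ : z ≤ n
          z≤ = <⇒≤ (<-≤-trans z<x x≤n)

  state : ℕ → List ℕ → List Step → Config m
  state k O s = layout (occupant k O s)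

  record Invariant (k : ℕ) (O : List ℕ) (s : List Step) : Set where
    field
      motzkin    : IsMotzkinFrom (length O) s
      remaining  : length s + k ≡ n
      decreasing : AllPairs _>_ O
      positive   : All (0 <_) O
      bounded    : All (_≤ k) O

  preference : ℕ → Step → List Step → Fin m
  preference k U s = spot (matchingCar k s)
  preference k F s = spot (suc k)
  preference k D s = spot (suc k)

  encode : ℕ → List Step → List (Fin m)
  encode k []      = []
  encode k (σ ∷ s) = preference k σ s ∷ encode (suc k) s

  openAfter : ℕ → Step → List ℕ → List ℕ
  openAfter k U O = suc k ∷ O
  openAfter k F O = O
  openAfter k D O = L.drop 1 O

  private
    ↦-≈ : v ≡ g y → (∀ z → z ≢ y → f z ≡ g z) → f [ y ↦ v ] ≈ g
    ↦-≈ {y = y} v≡ others z _ _ with z ≟ y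
    ... | yes refl = trans ↦-same v≡
    ... | no  z≢y  = trans (↦-other z≢y) (others z z≢y)

  arrival≤n : Invariant k O (σ ∷ s) → suc k ≤ n
  arrival≤n {k} {s = s} inv = ≤-trans (s≤s (m≤n+m k (length s))) (≤-reflexive (Invariant.remaining inv))

  matchingCar≤n : Invariant k O (U ∷ s) → matchingCar k s ≤ n
  matchingCar≤n {k} {O} {s} inv = begin
    suc (suc k) + closingIndex 0 s ≡⟨ +-suc (suc k) (closingIndex 0 s) ⟨
    suc k + suc (closingIndex 0 s) ≤⟨ +-monoʳ-≤ (suc k) (closingIndex<length (suc (length O)) s
                                       (IsMotzkinFrom-U⁻ (length O) motzkin) (s≤s z≤n)) ⟩
    suc k + length s              ≡⟨ +-comm (suc k) (length s) ⟩
    length s + suc k              ≡⟨ +-suc (length s) k ⟩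
    suc (length s + k)            ≡⟨ remaining ⟩
    n                             ∎
    where open Invariant inv
          open ≤-Reasoning

  matchingCar≢arrival : matchingCar k s ≢ suc k
  matchingCar≢arrival {k} {s} = >⇒≢ (s≤s (s≤s (m≤m+n k (closingIndex 0 s))))

  invariant-step : Invariant k O (σ ∷ s) → Invariant (suc k) (openAfter k σ O) s
  invariant-step {k} {O} {U} inv = record
    { motzkin    = IsMotzkinFrom-U⁻ (length O) motzkin
    ; remaining  = trans (+-suc _ k) remaining
    ; decreasing = All.map s≤s bounded ∷ decreasing
    ; positive   = s≤s z≤n ∷ positive
    ; bounded    = ≤-refl ∷ All.map m≤n⇒m≤1+n bounded
    }
    where open Invariant inv
  invariant-step {k} {O} {F} inv = record
    { motzkin    = IsMotzkinFrom-F⁻ (length O) motzkin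
    ; remaining  = trans (+-suc _ k) remaining
    ; decreasing = decreasing
    ; positive   = positive
    ; bounded    = All.map m≤n⇒m≤1+n bounded
    }
    where open Invariant inv
  invariant-step {k} {j ∷ O} {D} inv = record
    { motzkin    = motzkin
    ; remaining  = trans (+-suc _ k) remaining
    ; decreasing = AllPairs.tail decreasing
    ; positive   = All.tail positive
    ; bounded    = All.map m≤n⇒m≤1+n (All.tail bounded)
    }
    where open Invariant inv
  invariant-step {O = []} {D} inv = contradiction (Invariant.motzkin inv) λ ()

  step-forward : (inv : Invariant k O (σ ∷ s)) →
                 mvpStep (state k O (σ ∷ s)) (suc k) (preference k σ s) ≡
                 just (state (suc k) (openAfter k σ O) s)
  step-forward {k} {O} {U} {s} inv =
    trans (layout-park (s≤s z≤n) (matchingCar≤n inv) (occupant-U-match motzkin′))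
          (cong just (layout-cong (↦-≈ (sym (occupant-U-arrival motzkin′)) λ z → occupant-U-other)))
    where
      motzkin′ : IsMotzkinFrom (suc (length O)) s
      motzkin′ = IsMotzkinFrom-U⁻ (length O) (Invariant.motzkin inv)
  step-forward {k} {O} {F} inv =
    trans (layout-park (s≤s z≤n) (arrival≤n inv) occupant-F-arrival)
          (cong just (layout-cong (↦-≈ (sym (occupant-parked ≤-refl k+1∉)) λ z → occupant-F-other)))
    where
      open Invariant inv
      k+1∉ : suc k ∉ O
      k+1∉ = ∉-above (All.map s≤s bounded)
  step-forward {k} {j ∷ O} {D} {s} inv =
    trans (layout-bump (All.head positive) (s≤s j≤k) (arrival≤n inv) occupant-D-arrival
                       (occupant-D-bumped j≤k) between)
          (cong just (layout-cong (↦-≈ (sym (occupant-parked (m≤n⇒m≤1+n j≤k) (∉-above O<j)))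
                                       others)))
    where
      open Invariant inv
      j≤k : j ≤ k
      j≤k = All.head bounded

      O<j : All (_< j) O
      O<j = AllPairs.head decreasing

      between : ∀ z → j < z → z < suc k → occupant k (j ∷ O) (D ∷ s) z ≢ nothing
      between z j<z z≤k e = contradiction (trans (sym e) (occupant-parked (≤-pred z≤k) z∉)) λ ()
        where
          z∉ : z ∉ j ∷ O
          z∉ = ∉-above (j<z ∷ All.map (λ o<j → <-trans o<j j<z) O<j)

      others : ∀ z → z ≢ j →
               (occupant k (j ∷ O) (D ∷ s) [ suc k ↦ just (suc k) ]) z ≡ occupant (suc k) O s z
      others z z≢j with z ≟ suc k
      ... | yes refl = trans ↦-same (sym (occupant-parked ≤-refl k+1∉))
        where
          k+1∉ : suc k ∉ O
          k+1∉ = ∉-above (All.map (λ o<j → <-≤-trans o<j (m≤n⇒m≤1+n j≤k)) O<j)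
      ... | no z≢k+1 = trans (↦-other z≢k+1) (occupant-D-other z≢k+1 z≢j)
  step-forward {O = []} {D} inv = contradiction (Invariant.motzkin inv) λ ()

  record Preimage (k : ℕ) (s′ : List Step) (C : Config m) (a : Fin m) : Set where
    field
      step       : Step
      before     : List ℕ
      invariant  : Invariant k before (step ∷ s′)
      config     : C ≡ state k before (step ∷ s′)
      preferred  : a ≡ preference k step s′

  private
    weaken-bound : suc k ∉ O → All (_≤ suc k) O → All (_≤ k) O
    weaken-bound k+1∉ bnd = All.tabulate λ o∈ →
      ≤-pred (≤∧≢⇒< (All.lookup bnd o∈) λ o≡ → k+1∉ (subst (_∈ _) o≡ o∈))

  preimage-U : Invariant (suc k) (suc k ∷ O) s →
               Preimage k s (layout (occupant (suc k) (suc k ∷ O) s [ matchingCar k s ↦ nothing ]))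
                            (spot (matchingCar k s))
  preimage-U {k} {O} {s} inv = record
    { step      = U
    ; before    = O
    ; invariant = record
      { motzkin    = IsMotzkinFrom-U⁺ (length O) motzkin
      ; remaining  = trans (sym (+-suc _ k)) remaining
      ; decreasing = AllPairs.tail decreasing
      ; positive   = All.tail positive
      ; bounded    = All.map ≤-pred (AllPairs.head decreasing)
      }
    ; config    = layout-cong (↦-≈ (sym (occupant-U-match motzkin))
                                   λ z z≢ → sym (occupant-U-other z≢))
    ; preferred = refl
    }
    where open Invariant inv

  preimage-F : suc k ∉ O → Invariant (suc k) O s →
               Preimage k s (layout (occupant (suc k) O s [ suc k ↦ nothing ])) (spot (suc k))
  preimage-F {k} {O} {s} k+1∉ inv = record
    { step      = F
    ; before    = O
    ; invariant = record
      { motzkin    = IsMotzkinFrom-F⁺ (length O) motzkin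
      ; remaining  = trans (sym (+-suc _ k)) remaining
      ; decreasing = decreasing
      ; positive   = positive
      ; bounded    = weaken-bound k+1∉ bounded
      }
    ; config    = layout-cong (↦-≈ (sym occupant-F-arrival) λ z z≢ → sym (occupant-F-other z≢))
    ; preferred = refl
    }
    where open Invariant inv

  preimage-D : 0 < j → j ≤ k → j ∉ O → suc k ∉ O → (∀ z → j < z → z < suc k → z ∉ O) →
               Invariant (suc k) O s →
               Preimage k s (layout ((occupant (suc k) O s [ j ↦ nothing ]) [ suc k ↦ just j ]))
                            (spot (suc k))
  preimage-D {j} {k} {O} {s} 0<j j≤k j∉ k+1∉ gap inv = record
    { step      = D
    ; before    = j ∷ O
    ; invariant = record
      { motzkin    = motzkin
      ; remaining  = trans (sym (+-suc _ k)) remaining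
      ; decreasing = O<j ∷ decreasing
      ; positive   = 0<j ∷ positive
      ; bounded    = j≤k ∷ All.map (λ o<j → <⇒≤ (<-≤-trans o<j j≤k)) O<j
      }
    ; config    = layout-cong (↦-≈ (sym occupant-D-arrival) others)
    ; preferred = refl
    }
    where
      open Invariant inv

      O<j : All (_< j) O
      O<j = All.tabulate below
        where
          below : ∀ {o} → o ∈ O → o < j
          below {o} o∈ with <-cmp o j
          ... | tri< o<j _ _  = o<j
          ... | tri≈ _ refl _ = contradiction o∈ j∉
          ... | tri> _ _ j<o  =
            contradiction o∈ (gap o j<o (≤∧≢⇒< (All.lookup bounded o∈) o≢k+1))
            where
              o≢k+1 : o ≢ suc k
              o≢k+1 o≡ = k+1∉ (subst (_∈ O) o≡ o∈)

      others : ∀ z → z ≢ suc k →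
               (occupant (suc k) O s [ j ↦ nothing ]) z ≡ occupant k (j ∷ O) (D ∷ s) z
      others z z≢k+1 with z ≟ j
      ... | yes refl = trans ↦-same (sym (occupant-D-bumped j≤k))
      ... | no z≢j   = trans (↦-other z≢j) (sym (occupant-D-other z≢k+1 z≢j))

  step-backward : ∀ {k O′ s′ C C′ a} → Invariant (suc k) O′ s′ →
                  StepView C (suc k) a C′ → C′ ≡ state (suc k) O′ s′ → Preimage k s′ C a
  step-backward inv v C′≡ with layoutStep⁻ v C′≡
  ... | parked x 0<x x≤n gx≡
    with occupant-arrival⁻ (Invariant.decreasing inv) (Invariant.bounded inv) gx≡
  ...   | inj₁ (O₀ , refl , refl) = preimage-U inv
  ...   | inj₂ (k+1∉ , refl)      = preimage-F k+1∉ inv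
  step-backward {O′ = O′} inv v C′≡ | bumped x y 0<y y<x x≤n gx≡ gy≡ between
    with occupant-arrival⁻ (Invariant.decreasing inv) (Invariant.bounded inv) gx≡
  ...   | inj₁ (O₀ , refl , refl) =
    contradiction occupant-U-beforeMatch (bump-neighbour-occupied y<x gy≡ between)
  ...   | inj₂ (k+1∉ , refl) with occupant-past⁻ (<⇒≤ y<x) gy≡
  ...     | y∉ , refl = preimage-D 0<y (≤-pred y<x) y∉ k+1∉ gap inv
    where
      gap : ∀ z → y < z → z < x → z ∉ O′
      gap z y<z z<x = occupant≢nothing⇒∉ (<⇒≤ z<x) (between z y<z z<x)

  -- The last m − n cars

  opaque
    homeCell : ℕ → Fin m → Maybe ℕ
    homeCell k i with toℕ i <? n | toℕ i <? k
    ... | yes _ | _     = just (n ∸ toℕ i)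
    ... | no  _ | yes _ = just (suc (toℕ i))
    ... | no  _ | no  _ = nothing

    -- for n ≤ k: cars 1, …, k are all in their final spots
    home : ℕ → Config m
    home k = tabulate (homeCell k)

    lookup-home-low : ∀ i → toℕ i < n → lookup (home k) i ≡ just (n ∸ toℕ i)
    lookup-home-low {k} i i<n rewrite lookup∘tabulate (homeCell k) i with toℕ i <? n
    ... | yes _   = refl
    ... | no  i≮n = contradiction i<n i≮n

    lookup-home-parked : ∀ i → n ≤ toℕ i → toℕ i < k → lookup (home k) i ≡ just (suc (toℕ i))
    lookup-home-parked {k} i n≤i i<k
      rewrite lookup∘tabulate (homeCell k) i with toℕ i <? n | toℕ i <? k
    ... | yes i<n | _       = contradiction i<n (≤⇒≯ n≤i)
    ... | no  _   | yes _   = refl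
    ... | no  _   | no  i≮k = contradiction i<k i≮k

    lookup-home-empty : ∀ i → n ≤ toℕ i → k ≤ toℕ i → lookup (home k) i ≡ nothing
    lookup-home-empty {k} i n≤i k≤i
      rewrite lookup∘tabulate (homeCell k) i with toℕ i <? n | toℕ i <? k
    ... | yes i<n | _       = contradiction i<n (≤⇒≯ n≤i)
    ... | no  _   | yes i<k = contradiction i<k (≤⇒≯ k≤i)
    ... | no  _   | no  _   = refl

  lookup-home-other : ∀ i → toℕ i ≢ k → lookup (home k) i ≡ lookup (home (suc k)) i
  lookup-home-other {k} i i≢k with toℕ i <? n
  ... | yes i<n = trans (lookup-home-low i i<n) (sym (lookup-home-low i i<n))
  ... | no  i≮n with toℕ i <? k
  ...   | yes i<k = trans (lookup-home-parked i (≮⇒≥ i≮n) i<k)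
                          (sym (lookup-home-parked i (≮⇒≥ i≮n) (m≤n⇒m≤1+n i<k)))
  ...   | no  i≮k = trans (lookup-home-empty i (≮⇒≥ i≮n) (≮⇒≥ i≮k))
                          (sym (lookup-home-empty i (≮⇒≥ i≮n) (≤∧≢⇒< (≮⇒≥ i≮k) (≢-sym i≢k))))

  home-free : n ≤ k → k ≤ M → lookup (home k) (toFin k) ≡ nothing
  home-free {k} n≤k k≤M = lookup-home-empty (toFin k) (subst (n ≤_) (sym (toℕ-toFin k≤M)) n≤k)
                                                     (≤-reflexive (sym (toℕ-toFin k≤M)))

  home-update : n ≤ k → k ≤ M → home k [ toFin k ]≔ just (suc k) ≡ home (suc k)
  home-update {k} n≤k k≤M = lookup-ext pointwise
    where
      pointwise : ∀ i → lookup (home k [ toFin k ]≔ just (suc k)) i ≡ lookup (home (suc k)) i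
      pointwise i with i F.≟ toFin k
      ... | yes refl =
        trans (lookup∘update (toFin k) (home k) (just (suc k)))
              (sym (trans (lookup-home-parked (toFin k) (subst (n ≤_) (sym toℕ-k) n≤k)
                                                        (s≤s (≤-reflexive toℕ-k)))
                          (cong (λ c → just (suc c)) toℕ-k)))
        where
          toℕ-k : toℕ (toFin k) ≡ k
          toℕ-k = toℕ-toFin k≤M
      ... | no i≢k = trans (lookup∘update′ i≢k (home k) (just (suc k)))
                           (lookup-home-other i λ i≡k → i≢k (F.toℕ-injective (trans i≡k (sym toℕ-k))))
        where
          toℕ-k : toℕ (toFin k) ≡ k
          toℕ-k = toℕ-toFin k≤M

  home-step : n ≤ k → k ≤ M → mvpStep (home k) (suc k) (toFin k) ≡ just (home (suc k))
  home-step n≤k k≤M =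
    trans (mvpStep-park _ _ (home-free n≤k k≤M)) (cong just (home-update n≤k k≤M))

  home-arrival⁻ : ∀ {a} → n ≤ k → lookup (home (suc k)) a ≡ just (suc k) → toℕ a ≡ k
  home-arrival⁻ {k} {a} n≤k e with toℕ a <? n
  ... | yes a<n = contradiction (just-injective (trans (sym (lookup-home-low a a<n)) e))
                                (<⇒≢ (s≤s (≤-trans (m∸n≤m n (toℕ a)) n≤k)))
  ... | no  a≮n with toℕ a <? suc k
  ...   | yes a<k+1 =
    suc-injective (just-injective (trans (sym (lookup-home-parked a (≮⇒≥ a≮n) a<k+1)) e))
  ...   | no  a≮k+1 with () ← trans (sym (lookup-home-empty a (≮⇒≥ a≮n) (≮⇒≥ a≮k+1))) e

  home-step⁻ : ∀ {a} → n ≤ k → StepView C (suc k) a C′ → C′ ≡ home (suc k) →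
               C ≡ home k × a ≡ toFin k
  home-step⁻ {k} {C} {a = a} n≤k v C′≡ = config v C′≡ , a≡
    where
      a≡k : toℕ a ≡ k
      a≡k = home-arrival⁻ n≤k (trans (cong (λ D → lookup D a) (sym C′≡)) (StepView-arrival v))

      k≤M : k ≤ M
      k≤M = ≤-pred (subst (_< m) a≡k (F.toℕ<n a))

      a≡ : a ≡ toFin k
      a≡ = F.toℕ-injective (trans a≡k (sym (toℕ-toFin k≤M)))

      config : ∀ {C′} → StepView C (suc k) a C′ → C′ ≡ home (suc k) → C ≡ home k
      config (park free) C′≡ =
        trans ([]≔-undo free C′≡)
              (trans (cong (λ i → home (suc k) [ i ]≔ nothing) a≡)
                     (sym ([]≔-undo (home-free n≤k k≤M) (home-update n≤k k≤M))))
      config (bump j q _ ff) C′≡ = contradiction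
        (trans (sym (lookup-home-empty q (≤-trans n≤k (<⇒≤ k<q)) k<q))
               (trans (cong (λ D → lookup D q) (sym C′≡))
                      (lookup∘update q (C [ a ]≔ just (suc k)) (just j))))
        λ ()
        where
          k<q : k < toℕ q
          k<q = subst (_< toℕ q) a≡k (FirstFreeAfter.after (firstFreeAfter-sound ff))

  state-home : state n [] [] ≡ home n
  state-home = lookup-ext λ i → pointwise i (spotView i)
    where
      pointwise : ∀ i → SpotView i → lookup (state n [] []) i ≡ lookup (home n) i
      pointwise _ (carSpot x 0<x x≤n) =
        trans (lookup-layout-spot 0<x x≤n)
              (trans (occupant-parked x≤n λ ())
                     (sym (trans (lookup-home-low (spot x) (spot<n 0<x x≤n)) (cong just (∸-spot x≤n)))))
      pointwise i (beyond n≤i) = trans (lookup-layout-beyond n≤i) (sym (lookup-home-empty i n≤i n≤i))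

  home-target : home m ≡ V.map just (piPrime m n)
  home-target = lookup-ext λ i →
    trans (pointwise i)
          (sym (trans (lookup-map i just (piPrime m n)) (cong just (lookup∘tabulate π-entry i))))
    where
      π-entry : Fin m → ℕ
      π-entry j = if toℕ j <ᵇ n then n ∸ toℕ j else suc (toℕ j)

      pointwise : ∀ i → lookup (home m) i ≡ just (π-entry i)
      pointwise i with toℕ i <? n
      ... | yes i<n = trans (lookup-home-low i i<n) (cong just (sym (if-<ᵇ-true i<n)))
      ... | no  i≮n = trans (lookup-home-parked i (≮⇒≥ i≮n) (F.toℕ<n i))
                            (cong just (sym (if-<ᵇ-false (≮⇒≥ i≮n))))

  ownSpots : ℕ → ℕ → List (Fin m)
  ownSpots k zero    = []
  ownSpots k (suc r) = toFin k ∷ ownSpots (suc k) r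

  home-run : ∀ r → r + k ≡ m → n ≤ k → mvpRun (home k) (suc k) (ownSpots k r) ≡ just (home m)
  home-run zero    refl _   = refl
  home-run {k} (suc r) r+k≡ n≤k =
    trans (mvpRun-∷ {C = home k} (suc k) (toFin k) _ (home-step n≤k k≤M))
          (home-run r (trans (+-suc r k) r+k≡) (m≤n⇒m≤1+n n≤k))
    where
      k≤M : k ≤ M
      k≤M = ≤-trans (m≤n+m k r) (≤-reflexive (suc-injective r+k≡))

  home-run⁻ : ∀ {C} as → length as + k ≡ m → n ≤ k → mvpRun C (suc k) as ≡ just (home m) →
              C ≡ home k × as ≡ ownSpots k (length as)
  home-run⁻ []       refl _   run = just-injective run , refl
  home-run⁻ {k} {C} (a ∷ as) len n≤k run with mvpRun-∷⁻ {C = C} (suc k) a as run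
  ... | C′ , step≡ , run′
    with home-run⁻ as (trans (+-suc (length as) k) len) (m≤n⇒m≤1+n n≤k) run′
  ...   | C′≡ , as≡ with home-step⁻ n≤k (mvpStep-view {C = C} (suc k) a step≡) C′≡
  ...     | C≡ , a≡ = C≡ , cong₂ _∷_ a≡ as≡

  laterSpots : List (Fin m)
  laterSpots = ownSpots n (m ∸ n)

  private
    n≤m : n ≤ m
    n≤m = m≤n⇒m≤1+n n≤M

  encode-run : Invariant k O s → mvpRun (state k O s) (suc k) (encode k s ++ laterSpots) ≡ just (home m)
  encode-run {O = []} {s = []} inv with Invariant.remaining inv
  ... | refl = trans (cong (λ C → mvpRun C (suc n) laterSpots) state-home)
                     (home-run (m ∸ n) (m∸n+n≡m n≤m) ≤-refl)
  encode-run {O = _ ∷ _} {s = []} inv = contradiction (Invariant.motzkin inv) λ ()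
  encode-run {k} {O} {σ ∷ s} inv =
    trans (mvpRun-∷ {C = state k O (σ ∷ s)} (suc k) (preference k σ s) _ (step-forward inv))
          (encode-run (invariant-step inv))

  record Decoding (k : ℕ) (C : Config m) (as : List (Fin m)) : Set where
    field
      opened    : List ℕ
      path      : List Step
      invariant : Invariant k opened path
      config    : C ≡ state k opened path
      prefs     : as ≡ encode k path ++ laterSpots

  decode-run : ∀ as → k ≤ n → length as + k ≡ m → mvpRun C (suc k) as ≡ just (home m) →
               Decoding k C as
  decode-run {k} as k≤n len run with k ≟ n
  decode-run as _ len run | yes refl with home-run⁻ as len ≤-refl run
  ... | C≡ , as≡ = record
    { opened    = []
    ; path      = []
    ; invariant = record { motzkin = tt ; remaining = refl ; decreasing = [] ; positive = [] ; bounded = [] }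
    ; config    = trans C≡ (sym state-home)
    ; prefs     = trans as≡ (cong (ownSpots n) (sym (trans (cong (_∸ n) (sym len))
                                                         (m+n∸n≡m (length as) n))))
    }
  decode-run [] k≤n len run | no _ = contradiction (subst (_≤ M) len (≤-trans k≤n n≤M)) 1+n≰n
  decode-run {k} {C} (a ∷ as) k≤n len run | no k≢n with mvpRun-∷⁻ {C = C} (suc k) a as run
  ... | C′ , step≡ , run′
    with decode-run as (≤∧≢⇒< k≤n k≢n) (trans (+-suc (length as) k) len) run′
  ...   | d
    with step-backward (Decoding.invariant d) (mvpStep-view {C = C} (suc k) a step≡) (Decoding.config d)
  ...     | p = record
    { opened    = Preimage.before p
    ; path      = Preimage.step p ∷ Decoding.path d
    ; invariant = Preimage.invariant p
    ; config    = Preimage.config p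
    ; prefs     = cong₂ _∷_ (Preimage.preferred p) (Decoding.prefs d)
    }

  private
    lookup-state-arrival : Invariant k O (σ ∷ s) →
                           lookup (state k O (σ ∷ s)) (spot (suc k)) ≡ occupant k O (σ ∷ s) (suc k)
    lookup-state-arrival inv = lookup-layout-spot (s≤s z≤n) (arrival≤n inv)

    matchingCar-preference : Invariant k O (U ∷ s) → Invariant k O′ (σ ∷ s′) →
                             spot (matchingCar k s) ≢ spot (suc k)
    matchingCar-preference i₁ i₂ e =
      matchingCar≢arrival (spot-injective (matchingCar≤n i₁) (arrival≤n i₂) e)

    arrival-F≢D : Invariant k O (F ∷ s) → Invariant k O′ (D ∷ s′) →
                  state k O (F ∷ s) ≢ state k O′ (D ∷ s′)
    arrival-F≢D {O′ = []} _ i₂ _ = contradiction (Invariant.motzkin i₂) λ ()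
    arrival-F≢D {k} {O′ = j ∷ _} i₁ i₂ e = contradiction
      (trans (sym (trans (lookup-state-arrival i₁) occupant-F-arrival))
             (trans (cong (λ C → lookup C (spot (suc k))) e)
                    (trans (lookup-state-arrival i₂) occupant-D-arrival)))
      λ ()

  step-determined : Invariant k O (σ ∷ s) → Invariant k O′ (σ′ ∷ s′) →
                    state k O (σ ∷ s) ≡ state k O′ (σ′ ∷ s′) →
                    preference k σ s ≡ preference k σ′ s′ → σ ≡ σ′
  step-determined {σ = U} {σ′ = U} _ _ _ _ = refl
  step-determined {σ = F} {σ′ = F} _ _ _ _ = refl
  step-determined {σ = D} {σ′ = D} _ _ _ _ = refl
  step-determined {σ = U} {σ′ = F} i₁ i₂ _ e = contradiction e (matchingCar-preference i₁ i₂)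
  step-determined {σ = U} {σ′ = D} i₁ i₂ _ e = contradiction e (matchingCar-preference i₁ i₂)
  step-determined {σ = F} {σ′ = U} i₁ i₂ _ e = contradiction (sym e) (matchingCar-preference i₂ i₁)
  step-determined {σ = D} {σ′ = U} i₁ i₂ _ e = contradiction (sym e) (matchingCar-preference i₂ i₁)
  step-determined {σ = F} {σ′ = D} i₁ i₂ e _ = contradiction e (arrival-F≢D i₁ i₂)
  step-determined {σ = D} {σ′ = F} i₁ i₂ e _ = contradiction (sym e) (arrival-F≢D i₂ i₁)

  encode-injective : Invariant k O s → Invariant k O′ s′ → state k O s ≡ state k O′ s′ →
                     encode k s ≡ encode k s′ → s ≡ s′
  encode-injective {s = []}    {s′ = []}     _  _  _  _  = refl
  encode-injective {k} {O} {σ ∷ s} {O′} {σ′ ∷ s′} i₁ i₂ same enc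
    with step-determined i₁ i₂ same (L.∷-injectiveˡ enc)
  ... | refl =
    cong (σ ∷_) (encode-injective (invariant-step i₁) (invariant-step i₂) next (L.∷-injectiveʳ enc))
    where
      next : state (suc k) (openAfter k σ O) s ≡ state (suc k) (openAfter k σ O′) s′
      next = just-injective (begin
        just (state (suc k) (openAfter k σ O) s)   ≡⟨ step-forward i₁ ⟨
        mvpStep (state k O (σ ∷ s)) (suc k) (preference k σ s)
          ≡⟨ cong₂ (λ C a → mvpStep C (suc k) a) same (L.∷-injectiveˡ enc) ⟩
        mvpStep (state k O′ (σ ∷ s′)) (suc k) (preference k σ s′) ≡⟨ step-forward i₂ ⟩
        just (state (suc k) (openAfter k σ O′) s′) ∎)
        where open ≡-Reasoning

  length-encode : ∀ k s → length (encode k s) ≡ length s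
  length-encode k []      = refl
  length-encode k (σ ∷ s) = cong suc (length-encode (suc k) s)

  length-ownSpots : ∀ k r → length (ownSpots k r) ≡ r
  length-ownSpots k zero    = refl
  length-ownSpots k (suc r) = cong suc (length-ownSpots (suc k) r)

  -- The bijection

  π′ : Vec ℕ m
  π′ = piPrime m n

  empty-state : ∀ s → replicate m nothing ≡ state 0 [] s
  empty-state s = lookup-ext λ i → trans (lookup-replicate i nothing) (sym (pointwise i (spotView i)))
    where
      pointwise : ∀ i → SpotView i → lookup (state 0 [] s) i ≡ nothing
      pointwise _ (carSpot x 0<x x≤n) = trans (lookup-layout-spot 0<x x≤n) (occupant-initial 0<x)
      pointwise _ (beyond n≤i)        = lookup-layout-beyond n≤i

  initial-invariant : ∀ {s} → length s ≡ n → IsMotzkinFrom 0 s → Invariant 0 [] s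
  initial-invariant len p = record
    { motzkin = p ; remaining = trans (+-identityʳ _) len ; decreasing = [] ; positive = [] ; bounded = [] }

  initial-opened : ∀ {O s} → Invariant 0 O s → O ≡ []
  initial-opened {[]}    _   = refl
  initial-opened {_ ∷ _} inv with Invariant.positive inv | Invariant.bounded inv
  ... | 0<o ∷ _ | o≤0 ∷ _ = contradiction o≤0 (<⇒≱ 0<o)

  Decoding-path-unique : ∀ {as} (d₁ d₂ : Decoding k C as) → Decoding.path d₁ ≡ Decoding.path d₂
  Decoding-path-unique d₁ d₂ =
    encode-injective (invariant d₁) (invariant d₂) (trans (sym (config d₁)) (config d₂))
                     (L.++-cancelʳ laterSpots _ _ (trans (sym (prefs d₁)) (prefs d₂)))
    where open Decoding

  module FiberElement (α : Vec (Fin m) m) (outcome : mvpOutcome α ≡ just π′) where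
    decoding : Decoding 0 (replicate m nothing) (toList α)
    decoding = decode-run (toList α) z≤n (trans (+-identityʳ _) (length-toList α))
                          (trans (mvpOutcome-run α outcome) (cong just (sym home-target)))

    open Decoding decoding public

    path-length : length path ≡ n
    path-length = trans (sym (+-identityʳ _)) (Invariant.remaining invariant)

    path-motzkin : IsMotzkinFrom 0 path
    path-motzkin = subst (λ O → IsMotzkinFrom (length O) path) (initial-opened invariant)
                         (Invariant.motzkin invariant)

  toPath : MVPFiber m π′ → MotzkinPath n
  toPath (α , outcome) =
    vecOf path path-length , subst (IsMotzkinFrom 0) (sym (toList-vecOf path path-length)) path-motzkin
    where open FiberElement α outcome

  module Path (w : MotzkinPath n) where
    steps : List Step
    steps = toList (proj₁ w)

    invariant : Invariant 0 [] steps
    invariant = initial-invariant (length-toList (proj₁ w)) (proj₂ w)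

    prefs-length : length (encode 0 steps ++ laterSpots) ≡ m
    prefs-length = begin
      length (encode 0 steps ++ laterSpots)        ≡⟨ L.length-++ (encode 0 steps) ⟩
      length (encode 0 steps) + length laterSpots
        ≡⟨ cong₂ _+_ (length-encode 0 steps) (length-ownSpots n (m ∸ n)) ⟩
      length steps + (m ∸ n)                       ≡⟨ cong (_+ (m ∸ n)) (length-toList (proj₁ w)) ⟩
      n + (m ∸ n)                                  ≡⟨ m+[n∸m]≡n n≤m ⟩
      m                                            ∎
      where open ≡-Reasoning

    prefs : Vec (Fin m) m
    prefs = vecOf (encode 0 steps ++ laterSpots) prefs-length

    toList-prefs : toList prefs ≡ encode 0 steps ++ laterSpots
    toList-prefs = toList-vecOf _ prefs-length

    outcome : mvpOutcome prefs ≡ just π′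
    outcome = mvpOutcome-run⁻ prefs (begin
      mvpRun (replicate m nothing) 1 (toList prefs)
        ≡⟨ cong₂ (λ C as → mvpRun C 1 as) (empty-state steps) toList-prefs ⟩
      mvpRun (state 0 [] steps) 1 (encode 0 steps ++ laterSpots) ≡⟨ encode-run invariant ⟩
      just (home m)                                               ≡⟨ cong just home-target ⟩
      just (V.map just π′)                                        ∎)
      where open ≡-Reasoning

    decoding : Decoding 0 (replicate m nothing) (toList prefs)
    decoding = record
      { opened    = []
      ; path      = steps
      ; invariant = invariant
      ; config    = empty-state steps
      ; prefs     = toList-prefs
      }

  fromPath : MotzkinPath n → MVPFiber m π′
  fromPath w = prefs , outcome
    where open Path w

  toPath-fromPath : ∀ w → toPath (fromPath w) ≡ w
  toPath-fromPath w = MotzkinPath-≡ (toList-injective′ (trans (toList-vecOf E.path E.path-length)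
    (Decoding-path-unique E.decoding decoding)))
    where open Path w
          module E = FiberElement prefs outcome

  fromPath-toPath : ∀ f → fromPath (toPath f) ≡ f
  fromPath-toPath (α , outcome) = MVPFiber-≡ (toList-injective′ (begin
    toList (Path.prefs (toPath (α , outcome)))  ≡⟨ Path.toList-prefs (toPath (α , outcome)) ⟩
    encode 0 (toList (vecOf path path-length)) ++ laterSpots
      ≡⟨ cong (λ s → encode 0 s ++ laterSpots) (toList-vecOf path path-length) ⟩
    encode 0 path ++ laterSpots                ≡⟨ prefs ⟨
    toList α                                    ∎))
    where open FiberElement α outcome
          open ≡-Reasoning

  fiber↔MotzkinPaths : MVPFiber m π′ ↔ MotzkinPath n
  fiber↔MotzkinPaths = mk↔ₛ′ toPath fromPath toPath-fromPath fromPath-toPath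

corollary4p23 : (m n : ℕ) → n < m → MVPFiber m (piPrime m n) ↔ MotzkinPath n
corollary4p23 (suc M) n (s≤s n≤M) = fiber↔MotzkinPaths
  where open Correspondence n≤M
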